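{- For every $\eta>0$ and integers $m_1,\ell_2\ge 1$ there exist $C=C(\eta,m_1,\ell_2)$ and $n_0=n_0(\eta,m_1,\ell_2)$ such that the following holds for $n>n_0$. Let $\mathcal{H}$ be a $3$-uniform hypergraph with $n$ vertices and let $A=\{a_1,\dots,a_C\}\subseteq V(\mathcal{H})$ be such that for each $i\le C$ the link graph of $a_i$ restricted to $V(\mathcal{H})\setminus A$ has at least $\eta n^2$ edges. Then there exist two disjoint sets $W_1,W_2\subseteq V(\mathcal{H})$, each of size $m_1$, and a set $A'\subseteq A$ of size $\ell_2$, such that $w_1w_2a\in E(\mathcal{H})$ for every $w_1\in W_1$, $w_2\in W_2$ and $a\in A'$.
   Context: The link graph of a vertex $v$ in a $3$-uniform hypergraph $\mathcal{H}$ is the graph with edge set $\{xy : vxy\in E(\mathcal{H})\}$; its restriction to a vertex set $U$ keeps only the edges with both endpoints in $U$.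
   Formalization: The parameter η ranges over the positive rationals. -}

module Defs where

open import Data.Bool using (Bool; true; false; _∧_; not)
open import Data.Nat using (ℕ; _<ᵇ_)
open import Data.Fin using (Fin; toℕ)
open import Data.Fin.Properties using (_≟_)
open import Data.List using (List; allFin; length; filterᵇ; cartesianProduct)
open import Data.Bool.ListAction using (any)
open import Data.Product using (_×_; _,_)
open import Relation.Nullary using (¬_)
open import Relation.Nullary.Decidable using (⌊_⌋)
open import Relation.Binary.PropositionalEquality using (_≡_)

-- Edges are unordered
-- triples of distinct vertices, encoded by a symmetric Boolean indicator
-- E x y z (true iff {x,y,z} is an edge), which is only true for
-- pairwise distinct x, y, z.
record Hypergraph3 (n : ℕ) : Set where
  field
    E        : Fin n → Fin n → Fin n → Bool
    sym₁₂    : ∀ x y z → E x y z ≡ E y x z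
    sym₂₃    : ∀ x y z → E x y z ≡ E x z y
    distinct : ∀ x y z → E x y z ≡ true → ¬ (x ≡ y) × ¬ (y ≡ z) × ¬ (x ≡ z)

open Hypergraph3 public

inImage : ∀ {C n} → (Fin C → Fin n) → Fin n → Bool
inImage {C} a x = any (λ i → ⌊ a i ≟ x ⌋) (allFin C)

-- Number of edges of the link graph of v restricted to V(H) ∖ A, where
-- A is the image of a.  Each unordered pair {x , y} (x ≠ y) is counted once,
-- as the ordered pair with toℕ x < toℕ y.
linkEdgesOutside : ∀ {n C} → Hypergraph3 n → (Fin C → Fin n) → Fin n → ℕ
linkEdgesOutside {n} H a v =
  length (filterᵇ test (cartesianProduct (allFin n) (allFin n)))
  where
  test : Fin n × Fin n → Bool
  test (x , y) = (toℕ x <ᵇ toℕ y) ∧ not (inImage a x) ∧ not (inImage a y)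
                 ∧ E H v x y

module Submission where

-- Choose K with η ≥ 1/K, so each link graph G_i has at least n²/K edges (counted as ordered pairs)
-- and at least n/2K of its vertices have degree at least n/2K.  W₁ is built greedily, keeping a set B
-- of surviving indices and, for i ∈ B, the set N_i of those heavy vertices that are G_i-adjacent to
-- everything chosen so far.  Averaging over N_i, at least n/4K vertices x keep a 1/4K fraction of N_i
-- as neighbours; by double counting some unchosen x does so for at least |B|/8K indices of B, which
-- survive.  After m₁ rounds |N_i| ≥ n/R with R = 2K(4K)^m₁, and W₂ is built in the same way from
-- vertices lying in many N_i, losing a factor 2R per vertex.  So C = ℓ₂(8K)^m₁(2R)^m₁ leaves ℓ₂
-- indices, and n > n₀ keeps the vertices already chosen from spoiling the double counts.

module LinkBicliques where

  open import Data.Bool using (Bool; true; false; T; _∧_; _∨_; not)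
  open import Data.Bool.ListAction using (or)
  open import Data.Bool.Properties using (T-∨; T-≡)
  open import Data.Empty using (⊥-elim)
  open import Data.Fin using (Fin; zero; suc; toℕ; fromℕ<)
  open import Data.Fin.Properties using (_≟_; suc-injective)
  import Data.Integer as ℤ
  open import Data.Integer.Properties using (pos-*; drop‿+≤+)
  open import Data.List using (tabulate; length; filterᵇ; cartesianProduct; map; _++_)
  open import Data.List.Properties using (map-tabulate; filter-++; length-++)
  open import Data.Nat using (ℕ; zero; suc; _+_; _*_; _^_; _≤_; _<_; _<ᵇ_; z≤n; s≤s; z<s;
                              NonZero; >-nonZero; >-nonZero⁻¹)
  open import Data.Nat.Properties
    using (≤-refl; ≤-reflexive; ≤-trans; ≤-pred; <-irrefl; <-≤-trans; ≤-<-trans; <⇒≤; ≰⇒>; ≰⇒≥; _≤?_;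
           n≤1+n; m≤m+n; m≤n+m; m≤n*m; +-identityʳ; +-mono-≤; +-monoʳ-≤; +-cancelʳ-≤; *-identityʳ;
           *-zeroʳ; *-comm; *-assoc; *-mono-≤; *-monoʳ-≤; *-cancelˡ-≤; +-*-semiring;
           *-commutativeSemigroup; module ≤-Reasoning)
  open import Data.Nat.Tactic.RingSolver using (solve-∀)
  open import Data.Product using (Σ; ∃; _×_; _,_; proj₁; proj₂)
  open import Data.Rational as ℚ using (ℚ; mkℚ; Positive; _/_)
  open import Data.Rational.Properties using (toℚᵘ-mono-≤; toℚᵘ-homo-*; toℚᵘ-fromℚᵘ)
  import Data.Rational.Unnormalised as ℚᵘ
  open import Data.Rational.Unnormalised.Properties using (≤-respˡ-≃; ≤-respʳ-≃; *-congˡ; drop-*≤*)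
  open import Data.Sum using (inj₁; inj₂)
  open import Data.Vec.Functional using ([]; _∷_)
  open import Defs using (Hypergraph3; E; sym₁₂; sym₂₃; distinct; inImage; linkEdgesOutside)
  open import Function using (_∘_; Equivalence)
  open import Function.Definitions using (Injective)
  open import Relation.Binary.PropositionalEquality
  open import Relation.Nullary using (¬_; yes; no)
  open import Relation.Nullary.Decidable using (⌊_⌋; isYes≗does; fromWitness; toWitness; T?)
  open import Algebra.Properties.CommutativeSemigroup *-commutativeSemigroup using (x∙yz≈yx∙z)
  open import Algebra.Properties.Semiring.Sum +-*-semiring
    using (sum; sum-syntax; sum-cong-≗; ∑-comm; ∑-distrib-+; *-distribˡ-sum; *-distribʳ-sum)

  private
    variable
      k n : ℕ

  T-∧⁻ : ∀ a {b} → T (a ∧ b) → T a × T b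
  T-∧⁻ true Tb = _ , Tb

  *-positive : ∀ {a b} → 0 < a → 0 < b → 0 < a * b
  *-positive {a} {b} = *-mono-≤ {1} {a} {1} {b}

  ^-positive : ∀ {a} m → 0 < a → 0 < a ^ m
  ^-positive zero    0<a = z<s
  ^-positive (suc m) 0<a = *-positive 0<a (^-positive m 0<a)

  0<m≤a*b⇒0<b : ∀ {m b} a → 0 < m → m ≤ a * b → 0 < b
  0<m≤a*b⇒0<b {b = zero}  a 0<m m≤a*0 =
    ⊥-elim (<-irrefl refl (<-≤-trans 0<m (≤-trans m≤a*0 (≤-reflexive (*-zeroʳ a)))))
  0<m≤a*b⇒0<b {b = suc b} a _   _     = z<s

  𝟙 : Bool → ℕ
  𝟙 true  = 1
  𝟙 false = 0

  count : (Fin n → Bool) → ℕ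
  count P = sum (𝟙 ∘ P)

  ∑-mono-≤ : {f g : Fin n → ℕ} → (∀ x → f x ≤ g x) → sum f ≤ sum g
  ∑-mono-≤ {zero}  f≤g = z≤n
  ∑-mono-≤ {suc n} f≤g = +-mono-≤ (f≤g zero) (∑-mono-≤ (f≤g ∘ suc))

  ∑-const : ∀ n c → ∑[ x < n ] c ≡ n * c
  ∑-const zero    c = refl
  ∑-const (suc n) c = cong (c +_) (∑-const n c)

  ∑-≤-* : ∀ {f : Fin n → ℕ} c → (∀ x → f x ≤ c) → sum f ≤ n * c
  ∑-≤-* {n} c f≤c = ≤-trans (∑-mono-≤ f≤c) (≤-reflexive (∑-const n c))

  argmax : (f : Fin (suc n) → ℕ) → ∃ λ x → ∀ y → f y ≤ f x
  argmax {zero}  f = zero , λ { zero → ≤-refl }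
  argmax {suc n} f with argmax (f ∘ suc)
  ... | x , f≤fx with f zero ≤? f (suc x)
  ...   | yes f0≤fx = suc x , λ { zero → f0≤fx ; (suc y) → f≤fx y }
  ...   | no  f0≰fx = zero  , λ { zero → ≤-refl ; (suc y) → ≤-trans (f≤fx y) (≰⇒≥ f0≰fx) }

  pigeonhole : .{{NonZero n}} → ∀ {c} (f : Fin n → ℕ) → n * c ≤ sum f → ∃ λ x → c ≤ f x
  pigeonhole {suc n} f n*c≤∑f =
    let x , f≤fx = argmax f in x , *-cancelˡ-≤ (suc n) (≤-trans n*c≤∑f (∑-≤-* (f x) f≤fx))

  𝟙-mono : ∀ {a b} → (T a → T b) → 𝟙 a ≤ 𝟙 b
  𝟙-mono {false}         _   = z≤n
  𝟙-mono {true}  {true}  _   = ≤-refl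
  𝟙-mono {true}  {false} a⇒b = ⊥-elim (a⇒b _)

  count-mono : {P Q : Fin n → Bool} → (∀ x → T (P x) → T (Q x)) → count P ≤ count Q
  count-mono P⇒Q = ∑-mono-≤ (λ x → 𝟙-mono (P⇒Q x))

  count-≤ : (P : Fin n → Bool) → count P ≤ n
  count-≤ {n} P = ≤-trans (∑-≤-* 1 (λ x → 𝟙≤1 (P x))) (≤-reflexive (*-identityʳ n))
    where
    𝟙≤1 : ∀ b → 𝟙 b ≤ 1
    𝟙≤1 true  = ≤-refl
    𝟙≤1 false = z≤n

  count-true : ∀ n → count {n} (λ _ → true) ≡ n
  count-true n = trans (∑-const n 1) (*-identityʳ n)

  count-false : ∀ n → count {n} (λ _ → false) ≡ 0
  count-false n = trans (∑-const n 0) (*-zeroʳ n)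

  count-∨ : (P Q : Fin n → Bool) → count (λ x → P x ∨ Q x) ≤ count P + count Q
  count-∨ P Q = ≤-trans (∑-mono-≤ (λ x → 𝟙-∨ (P x) (Q x))) (≤-reflexive (∑-distrib-+ (𝟙 ∘ P) (𝟙 ∘ Q)))
    where
    𝟙-∨ : ∀ a b → 𝟙 (a ∨ b) ≤ 𝟙 a + 𝟙 b
    𝟙-∨ true  b = s≤s z≤n
    𝟙-∨ false b = ≤-refl

  count-split : (P Z : Fin n → Bool) → count P ≤ count (λ x → P x ∧ not (Z x)) + count Z
  count-split P Z = ≤-trans (count-mono split) (count-∨ (λ x → P x ∧ not (Z x)) Z)
    where
    split : ∀ x → T (P x) → T ((P x ∧ not (Z x)) ∨ Z x)
    split x _ with P x | Z x
    ... | true | true  = _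
    ... | true | false = _

  count-≟ : (z : Fin n) → count (λ x → ⌊ z ≟ x ⌋) ≡ 1
  count-≟ {suc n} zero    = cong suc (count-false n)
  count-≟ {suc n} (suc z) =
    -- ⌊_⌋ (isYes) is stuck on the map′ inside suc z ≟ suc x, whereas does reduces through it.
    trans (sum-cong-≗ (λ x → cong 𝟙 (trans (isYes≗does (suc z ≟ suc x)) (sym (isYes≗does (z ≟ x))))))
          (count-≟ z)

  count-positive : (P : Fin n → Bool) → 0 < count P → ∃ λ x → T (P x)
  count-positive {suc n} P 0<count with P zero in eq
  ... | true  = zero , subst T (sym eq) _
  ... | false = let x , Px = count-positive (P ∘ suc) 0<count in suc x , Px

  ∷-injective : ∀ {f : Fin k → Fin n} {x} →
                Injective _≡_ _≡_ f → (∀ i → f i ≢ x) → Injective _≡_ _≡_ (x ∷ f)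
  ∷-injective f-inj fi≢x {zero}  {zero}  _  = refl
  ∷-injective f-inj fi≢x {zero}  {suc j} eq = ⊥-elim (fi≢x j (sym eq))
  ∷-injective f-inj fi≢x {suc i} {zero}  eq = ⊥-elim (fi≢x i eq)
  ∷-injective f-inj fi≢x {suc i} {suc j} eq = cong suc (f-inj eq)

  ≤count⇒injection : (P : Fin n → Bool) → k ≤ count P →
                     Σ (Fin k → Fin n) λ g → Injective _≡_ _≡_ g × (∀ i → T (P (g i)))
  ≤count⇒injection {k = zero}  P _ = [] , (λ { {()} }) , λ ()
  ≤count⇒injection {suc n} {k = suc k} P k≤count with P zero in eq
  ... | true  = let g , g-inj , Pg = ≤count⇒injection (P ∘ suc) (≤-pred k≤count)
                in zero ∷ (suc ∘ g) , ∷-injective (g-inj ∘ suc-injective) (λ _ ()) ,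
                   λ { zero → subst T (sym eq) _ ; (suc i) → Pg i }
  ... | false = let g , g-inj , Pg = ≤count⇒injection (P ∘ suc) k≤count
                in suc ∘ g , g-inj ∘ suc-injective , Pg

  inImage-suc : ∀ (f : Fin (suc k) → Fin n) x → inImage f x ≡ ⌊ f zero ≟ x ⌋ ∨ inImage (f ∘ suc) x
  inImage-suc f x = cong (λ bs → ⌊ f zero ≟ x ⌋ ∨ or bs)
    (trans (map-tabulate suc f≟x) (sym (map-tabulate (λ i → i) (f≟x ∘ suc))))
    where
    f≟x : Fin _ → Bool
    f≟x i = ⌊ f i ≟ x ⌋

  inImage-complete : ∀ (f : Fin k → Fin n) i → T (inImage f (f i))
  inImage-complete f zero    = subst T (sym (inImage-suc f (f zero)))
    (Equivalence.from T-∨ (inj₁ (fromWitness {a? = f zero ≟ f zero} refl)))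
  inImage-complete f (suc i) = subst T (sym (inImage-suc f (f (suc i))))
    (Equivalence.from T-∨ (inj₂ (inImage-complete (f ∘ suc) i)))

  ∉inImage⇒≢ : ∀ {f : Fin k → Fin n} {x} → ¬ T (inImage f x) → ∀ i → f i ≢ x
  ∉inImage⇒≢ {f = f} x∉f i fi≡x = x∉f (subst (T ∘ inImage f) fi≡x (inImage-complete f i))

  count-inImage : (f : Fin k → Fin n) → count (inImage f) ≤ k
  count-inImage {zero}  {n} f = ≤-reflexive (count-false n)
  count-inImage {suc k}     f = begin
    count (inImage f)                                        ≡⟨ sum-cong-≗ (cong 𝟙 ∘ inImage-suc f) ⟩
    count (λ x → ⌊ f zero ≟ x ⌋ ∨ inImage (f ∘ suc) x)       ≤⟨ count-∨ (λ x → ⌊ f zero ≟ x ⌋) (inImage (f ∘ suc)) ⟩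
    count (λ x → ⌊ f zero ≟ x ⌋) + count (inImage (f ∘ suc)) ≤⟨ +-mono-≤ (≤-reflexive (count-≟ (f zero)))
                                                                         (count-inImage (f ∘ suc)) ⟩
    suc k                                                    ∎
    where open ≤-Reasoning

  -- The elements outside P contribute at most S/2 to c · sum f, hence those in P at least S/2.
  count-heavy : (f : Fin n → ℕ) (P : Fin n → Bool) {M c S : ℕ} → (∀ x → f x ≤ M) →
                (∀ x → ¬ T (P x) → 2 * c * n * f x ≤ S) → S ≤ c * sum f →
                S ≤ 2 * c * (M * count P)
  count-heavy {zero}  f P {c = c} _ _ S≤c*∑f = ≤-trans (≤-trans S≤c*∑f (≤-reflexive (*-zeroʳ c))) z≤n
  count-heavy {suc n} f P {M} {c} {S} f≤M light S≤c*∑f =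
    *-cancelˡ-≤ N (+-cancelʳ-≤ (N * S) (N * S) (N * (2 * c * (M * count P))) (begin
      N * S + N * S                              ≡⟨ regroup₁ N S ⟩
      2 * N * S                                  ≤⟨ *-monoʳ-≤ (2 * N) S≤c*∑f ⟩
      2 * N * (c * sum f)                        ≡⟨ regroup₂ N c (sum f) ⟩
      2 * c * N * sum f                          ≡⟨ *-distribˡ-sum (2 * c * N) f ⟩
      ∑[ x < N ] (2 * c * N * f x)               ≤⟨ ∑-mono-≤ pointwise ⟩
      ∑[ x < N ] (𝟙 (P x) * (2 * c * N * M) + S) ≡⟨ ∑-distrib-+ (λ x → 𝟙 (P x) * (2 * c * N * M)) (λ _ → S) ⟩
      ∑[ x < N ] (𝟙 (P x) * (2 * c * N * M)) + ∑[ x < N ] S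
                                                 ≡⟨ cong₂ _+_ (sym (*-distribʳ-sum (2 * c * N * M) (𝟙 ∘ P))) (∑-const N S) ⟩
      count P * (2 * c * N * M) + N * S          ≡⟨ cong (_+ N * S) (regroup₃ N c M (count P)) ⟩
      N * (2 * c * (M * count P)) + N * S        ∎))
    where
    open ≤-Reasoning
    N = suc n
    pointwise : ∀ x → 2 * c * N * f x ≤ 𝟙 (P x) * (2 * c * N * M) + S
    pointwise x with P x | light x
    ... | true  | _     = ≤-trans (≤-trans (*-monoʳ-≤ (2 * c * N) (f≤M x)) (≤-reflexive (sym (+-identityʳ _))))
                                  (m≤m+n _ S)
    ... | false | light = light λ ()
    regroup₁ : ∀ N S → N * S + N * S ≡ 2 * N * S
    regroup₁ = solve-∀
    regroup₂ : ∀ N c s → 2 * N * (c * s) ≡ 2 * c * N * s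
    regroup₂ = solve-∀
    regroup₃ : ∀ N c M k → k * (2 * c * N * M) ≡ N * (2 * c * (M * k))
    regroup₃ = solve-∀

  count-outside : (P Z : Fin n → Bool) (Q : ℕ) {z : ℕ} → n ≤ Q * count P → count Z ≤ z → 2 * Q * z ≤ n →
                  n ≤ 2 * Q * count (λ x → P x ∧ not (Z x))
  count-outside {n} P Z Q {z} n≤Q∣P∣ ∣Z∣≤z 2Qz≤n = +-cancelʳ-≤ n n (2 * Q * c) (begin
    n + n                         ≤⟨ +-mono-≤ n≤Q∣P∣ n≤Q∣P∣ ⟩
    Q * count P + Q * count P     ≤⟨ +-mono-≤ Q∣P∣≤ Q∣P∣≤ ⟩
    Q * (c + z) + Q * (c + z)     ≡⟨ regroup Q c z ⟩
    2 * Q * c + 2 * Q * z         ≤⟨ +-monoʳ-≤ (2 * Q * c) 2Qz≤n ⟩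
    2 * Q * c + n                 ∎)
    where
    open ≤-Reasoning
    c = count (λ x → P x ∧ not (Z x))
    regroup : ∀ Q c z → Q * (c + z) + Q * (c + z) ≡ 2 * Q * c + 2 * Q * z
    regroup = solve-∀
    Q∣P∣≤ : Q * count P ≤ Q * (c + z)
    Q∣P∣≤ = *-monoʳ-≤ Q (≤-trans (count-split P Z) (+-monoʳ-≤ c ∣Z∣≤z))

  -- Each i ∈ B has at least n/2Q elements of P i outside Z; double count the pairs (i , x).
  popular-vertex : .{{NonZero n}} → ∀ {C} (B : Fin C → Bool) (P : Fin C → Fin n → Bool)
                   (Z : Fin n → Bool) (Q : ℕ) {z : ℕ} → 0 < count B →
                   (∀ i → T (B i) → n ≤ Q * count (P i)) → count Z ≤ z → 2 * Q * z ≤ n →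
                   ∃ λ x → ¬ T (Z x) × count B ≤ 2 * Q * count (λ i → B i ∧ P i x)
  popular-vertex {n} {C} B P Z Q 0<∣B∣ P-large ∣Z∣≤z 2Qz≤n =
    x , x∉Z , ≤-trans B≤2Qhx (*-monoʳ-≤ (2 * Q) (count-mono (λ i → drop-∉Z (B i) (P i x))))
    where
    open ≤-Reasoning
    P∖Z : Fin C → Fin n → Bool
    P∖Z i x = P i x ∧ not (Z x)
    h : Fin n → ℕ
    h x = count (λ i → B i ∧ P∖Z i x)

    pointwise : ∀ i → 𝟙 (B i) * n ≤ 2 * Q * ∑[ x < n ] 𝟙 (B i ∧ P∖Z i x)
    pointwise i with B i | P-large i
    ... | true  | large = ≤-trans (≤-reflexive (+-identityʳ n)) (count-outside (P i) Z Q (large _) ∣Z∣≤z 2Qz≤n)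
    ... | false | _     = z≤n

    n∣B∣≤∑2Qh : n * count B ≤ ∑[ x < n ] (2 * Q * h x)
    n∣B∣≤∑2Qh = begin
      n * count B                                            ≡⟨ *-comm n (count B) ⟩
      count B * n                                            ≡⟨ *-distribʳ-sum n (𝟙 ∘ B) ⟩
      ∑[ i < C ] (𝟙 (B i) * n)                               ≤⟨ ∑-mono-≤ pointwise ⟩
      ∑[ i < C ] (2 * Q * ∑[ x < n ] 𝟙 (B i ∧ P∖Z i x))      ≡⟨ *-distribˡ-sum (2 * Q) (λ i → ∑[ x < n ] 𝟙 (B i ∧ P∖Z i x)) ⟨
      2 * Q * ∑[ i < C ] ∑[ x < n ] 𝟙 (B i ∧ P∖Z i x)        ≡⟨ cong (2 * Q *_) (∑-comm (λ i x → 𝟙 (B i ∧ P∖Z i x))) ⟩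
      2 * Q * ∑[ x < n ] h x                                 ≡⟨ *-distribˡ-sum (2 * Q) h ⟩
      ∑[ x < n ] (2 * Q * h x)                               ∎

    chosen = pigeonhole (λ x → 2 * Q * h x) n∣B∣≤∑2Qh
    x = proj₁ chosen
    B≤2Qhx = proj₂ chosen

    0<hx : 0 < h x
    0<hx = 0<m≤a*b⇒0<b (2 * Q) 0<∣B∣ B≤2Qhx

    x∉Z : ¬ T (Z x)
    x∉Z = let i , BPZ = count-positive (λ i → B i ∧ P∖Z i x) 0<hx in ∉-of (B i) (P i x) (Z x) BPZ
      where
      ∉-of : ∀ b p z → T (b ∧ (p ∧ not z)) → ¬ T z
      ∉-of true true false _ ()

    drop-∉Z : ∀ b p → T (b ∧ (p ∧ not (Z x))) → T (b ∧ p)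
    drop-∉Z true true _ = _

  record CommonElements {C n} (B : Fin C → Bool) (P : Fin C → Fin n → Bool) (D m : ℕ) : Set where
    field
      elements           : Fin m → Fin n
      elements-injective : Injective _≡_ _≡_ elements
      survivors          : Fin C → Bool
      survivors⊆B        : ∀ {i} → T (survivors i) → T (B i)
      survivors-large    : count B ≤ D * count survivors
      common             : ∀ {i} → T (survivors i) → ∀ k → T (P i (elements k))

  greedy-common-elements : .{{NonZero n}} → ∀ {C} (B : Fin C → Bool) (P : Fin C → Fin n → Bool) Q m →
                           0 < count B → (∀ i → T (B i) → n ≤ Q * count (P i)) → 2 * Q * m ≤ n →
                           CommonElements B P ((2 * Q) ^ m) m
  greedy-common-elements B P Q zero 0<∣B∣ P-large _ = record
    { elements           = []
    ; elements-injective = λ { {()} }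
    ; survivors          = B
    ; survivors⊆B        = λ Bi → Bi
    ; survivors-large    = ≤-reflexive (sym (+-identityʳ (count B)))
    ; common             = λ _ ()
    }
  greedy-common-elements {n} {C} B P Q (suc m) 0<∣B∣ P-large 2Q[1+m]≤n = record
    { elements           = y ∷ elements
    ; elements-injective = ∷-injective elements-injective (∉inImage⇒≢ y-fresh)
    ; survivors          = survivors′
    ; survivors⊆B        = λ {i} S′i → survivors⊆B (proj₁ (T-∧⁻ (survivors i) S′i))
    ; survivors-large    = ≤-trans survivors-large (≤-trans (*-monoʳ-≤ ((2 * Q) ^ m) y-popular)
                                     (≤-reflexive (x∙yz≈yx∙z ((2 * Q) ^ m) (2 * Q) (count survivors′))))
    ; common             = λ { {i} S′i zero    → proj₂ (T-∧⁻ (survivors i) S′i)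
                             ; {i} S′i (suc k) → common (proj₁ (T-∧⁻ (survivors i) S′i)) k }
    }
    where
    2Qm≤n : 2 * Q * m ≤ n
    2Qm≤n = ≤-trans (*-monoʳ-≤ (2 * Q) (n≤1+n m)) 2Q[1+m]≤n
    open CommonElements (greedy-common-elements B P Q m 0<∣B∣ P-large 2Qm≤n)
    vertex : ∃ λ y → ¬ T (inImage elements y) × count survivors ≤ 2 * Q * count (λ i → survivors i ∧ P i y)
    vertex = popular-vertex survivors P (inImage elements) Q (0<m≤a*b⇒0<b ((2 * Q) ^ m) 0<∣B∣ survivors-large)
               (λ i Si → P-large i (survivors⊆B Si)) (count-inImage elements) 2Qm≤n
    y = proj₁ vertex
    y-fresh = proj₁ (proj₂ vertex)
    y-popular = proj₂ (proj₂ vertex)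
    survivors′ : Fin C → Bool
    survivors′ i = survivors i ∧ P i y

  edgeCount : (Fin n → Fin n → Bool) → ℕ
  edgeCount {n} G = ∑[ x < n ] count (G x)

  neighbourhoodFactor : ℕ → ℕ → ℕ
  neighbourhoodFactor K m = 2 * K * (4 * K) ^ m

  bicliqueFactor : ℕ → ℕ → ℕ
  bicliqueFactor K m = (8 * K) ^ m * (2 * neighbourhoodFactor K m) ^ m

  bicliqueThreshold : ℕ → ℕ → ℕ
  bicliqueThreshold K m = 2 * (4 * K) * m + 2 * neighbourhoodFactor K m * m

  bicliqueFactor-positive : ∀ {K} m → 0 < K → 0 < bicliqueFactor K m
  bicliqueFactor-positive {K} m 0<K =
    *-positive (^-positive m (0<c*K 8)) (^-positive m (*-positive {2} z<s 0<R))
    where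
    0<c*K : ∀ c → .{{NonZero c}} → 0 < c * K
    0<c*K c = *-positive (>-nonZero⁻¹ c) 0<K
    0<R : 0 < neighbourhoodFactor K m
    0<R = *-positive (0<c*K 2) (^-positive m (0<c*K 4))

  module CommonBiclique {C n K : ℕ} .{{_ : NonZero n}}
                        (G : Fin C → Fin n → Fin n → Bool)
                        (dense : ∀ i → n * n ≤ K * edgeCount (G i)) where

    deg : Fin C → Fin n → ℕ
    deg i y = count (λ x → G i x y)

    heavy : Fin C → Fin n → Bool
    heavy i y = ⌊ n ≤? 2 * K * deg i y ⌋

    heavy-large : ∀ i → n ≤ 2 * K * count (heavy i)
    heavy-large i = *-cancelˡ-≤ n (≤-trans n*n≤ (≤-reflexive (regroup K n (count (heavy i)))))
      where
      regroup : ∀ K n c → 2 * K * (n * c) ≡ n * (2 * K * c)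
      regroup = solve-∀
      regroup₂ : ∀ K n d → 2 * K * n * d ≡ n * (2 * K * d)
      regroup₂ = solve-∀
      light : ∀ y → ¬ T (heavy i y) → 2 * K * n * deg i y ≤ n * n
      light y ¬heavy = ≤-trans (≤-reflexive (regroup₂ K n (deg i y)))
                               (*-monoʳ-≤ n (<⇒≤ (≰⇒> (¬heavy ∘ fromWitness))))
      n*n≤ : n * n ≤ 2 * K * (n * count (heavy i))
      n*n≤ = count-heavy (deg i) (heavy i) {c = K} (λ y → count-≤ (λ x → G i x y)) light
               (≤-trans (dense i) (≤-reflexive (cong (K *_) (∑-comm (λ x y → 𝟙 (G i x y))))))

    record CommonNeighbourhoods (j : ℕ) : Set where
      field
        X           : Fin j → Fin n
        X-injective : Injective _≡_ _≡_ X
        B           : Fin C → Bool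
        N           : Fin C → Fin n → Bool
        B-large     : C ≤ (8 * K) ^ j * count B
        N-large     : ∀ {i} → T (B i) → n ≤ neighbourhoodFactor K j * count (N i)
        N-heavy     : ∀ {i y} → T (N i y) → n ≤ 2 * K * deg i y
        N-adjacent  : ∀ {i y} → T (N i y) → ∀ k → T (G i (X k) y)

    initial : CommonNeighbourhoods 0
    initial = record
      { X           = []
      ; X-injective = λ { {()} }
      ; B           = λ _ → true
      ; N           = heavy
      ; B-large     = ≤-reflexive (sym (trans (+-identityʳ _) (count-true C)))
      ; N-large     = λ {i} _ → ≤-trans (heavy-large i) (≤-reflexive (cong (_* count (heavy i)) (sym (*-identityʳ (2 * K)))))
      ; N-heavy     = toWitness
      ; N-adjacent  = λ _ ()
      }

    module Extend {j} (s : CommonNeighbourhoods j) where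
      open CommonNeighbourhoods s

      N-adj : Fin C → Fin n → Fin n → Bool
      N-adj i x y = N i y ∧ G i x y

      popular : Fin C → Fin n → Bool
      popular i x = ⌊ count (N i) ≤? 4 * K * count (N-adj i x) ⌋

      popular-large : ∀ {i} → T (B i) → n ≤ 4 * K * count (popular i)
      popular-large {i} Bi = *-cancelˡ-≤ t {{>-nonZero 0<t}} (≤-trans tn≤ (≤-reflexive (regroup K t (count (popular i)))))
        where
        open ≤-Reasoning
        t = count (N i)
        f : Fin n → ℕ
        f x = count (N-adj i x)
        regroup : ∀ K t p → 2 * (2 * K) * (t * p) ≡ t * (4 * K * p)
        regroup = solve-∀
        regroup₂ : ∀ K n f → 2 * (2 * K) * n * f ≡ n * (4 * K * f)
        regroup₂ = solve-∀
        0<t : 0 < t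
        0<t = 0<m≤a*b⇒0<b (neighbourhoodFactor K j) (>-nonZero⁻¹ n) (N-large Bi)
        light : ∀ x → ¬ T (popular i x) → 2 * (2 * K) * n * f x ≤ t * n
        light x ¬popular = ≤-trans (≤-reflexive (regroup₂ K n (f x)))
          (≤-trans (*-monoʳ-≤ n (<⇒≤ (≰⇒> (¬popular ∘ fromWitness)))) (≤-reflexive (*-comm n t)))
        pointwise : ∀ y → 𝟙 (N i y) * n ≤ 2 * K * count (λ x → N-adj i x y)
        pointwise y with N i y in Niy
        ... | true  = ≤-trans (≤-reflexive (+-identityʳ n)) (N-heavy (subst T (sym Niy) _))
        ... | false = z≤n
        tn≤∑f : t * n ≤ 2 * K * sum f
        tn≤∑f = begin
          t * n                                               ≡⟨ *-distribʳ-sum n (𝟙 ∘ N i) ⟩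
          ∑[ y < n ] (𝟙 (N i y) * n)                          ≤⟨ ∑-mono-≤ pointwise ⟩
          ∑[ y < n ] (2 * K * count (λ x → N-adj i x y))      ≡⟨ *-distribˡ-sum (2 * K) (λ y → count (λ x → N-adj i x y)) ⟨
          2 * K * ∑[ y < n ] ∑[ x < n ] 𝟙 (N-adj i x y)        ≡⟨ cong (2 * K *_) (∑-comm (λ y x → 𝟙 (N-adj i x y))) ⟩
          2 * K * sum f                                       ∎
        tn≤ : t * n ≤ 2 * (2 * K) * (t * count (popular i))
        tn≤ = count-heavy f (popular i) {c = 2 * K} (λ x → count-mono (λ y → proj₁ ∘ T-∧⁻ (N i y))) light tn≤∑f

      extend : 0 < C → 2 * (4 * K) * j ≤ n → CommonNeighbourhoods (suc j)
      extend 0<C 8Kj≤n = record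
        { X           = x ∷ X
        ; X-injective = ∷-injective X-injective (∉inImage⇒≢ x-fresh)
        ; B           = λ i → B i ∧ popular i x
        ; N           = λ i → N-adj i x
        ; B-large     = ≤-trans B-large (≤-trans (*-monoʳ-≤ ((8 * K) ^ j) x-popular)
                                                 (≤-reflexive (regroup K ((8 * K) ^ j) _)))
        ; N-large     = λ {i} B′i → let Bi , popular-ix = T-∧⁻ (B i) B′i in
                          ≤-trans (N-large Bi) (≤-trans (*-monoʳ-≤ (neighbourhoodFactor K j) (toWitness popular-ix))
                                                        (≤-reflexive (regroup₂ K ((4 * K) ^ j) _)))
        ; N-heavy     = λ {i} {y} N′iy → N-heavy (proj₁ (T-∧⁻ (N i y) N′iy))
        ; N-adjacent  = λ { {i} {y} N′iy zero    → proj₂ (T-∧⁻ (N i y) N′iy)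
                          ; {i} {y} N′iy (suc k) → N-adjacent (proj₁ (T-∧⁻ (N i y) N′iy)) k }
        }
        where
        regroup : ∀ K P b → P * (2 * (4 * K) * b) ≡ 8 * K * P * b
        regroup = solve-∀
        regroup₂ : ∀ K P f → 2 * K * P * (4 * K * f) ≡ 2 * K * (4 * K * P) * f
        regroup₂ = solve-∀
        vertex : ∃ λ x → ¬ T (inImage X x) × count B ≤ 2 * (4 * K) * count (λ i → B i ∧ popular i x)
        vertex = popular-vertex B popular (inImage X) (4 * K) (0<m≤a*b⇒0<b ((8 * K) ^ j) 0<C B-large)
                   (λ i → popular-large) (count-inImage X) 8Kj≤n
        x = proj₁ vertex
        x-fresh = proj₁ (proj₂ vertex)
        x-popular = proj₂ (proj₂ vertex)

    common-neighbourhoods : 0 < C → ∀ j → 2 * (4 * K) * j ≤ n → CommonNeighbourhoods j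
    common-neighbourhoods 0<C zero    _         = initial
    common-neighbourhoods 0<C (suc j) 8K[1+j]≤n =
      Extend.extend (common-neighbourhoods 0<C j 8Kj≤n) 0<C 8Kj≤n
      where
      8Kj≤n = ≤-trans (*-monoʳ-≤ (2 * (4 * K)) (n≤1+n j)) 8K[1+j]≤n

    biclique : ∀ m ℓ → 0 < ℓ → 0 < K → ℓ * bicliqueFactor K m ≤ C → bicliqueThreshold K m ≤ n →
               Σ (Fin m → Fin n) λ X → Σ (Fin m → Fin n) λ Y → Σ (Fin ℓ → Fin C) λ g →
                 Injective _≡_ _≡_ X × Injective _≡_ _≡_ Y × Injective _≡_ _≡_ g ×
                 (∀ i j k → T (G (g k) (X i) (Y j)))
    biclique m ℓ 0<ℓ 0<K ℓΦ≤C n₀≤n =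
      X , elements , g , X-injective , elements-injective , g-injective ,
      λ i j k → N-adjacent (common (g-survives k) j) i
      where
      R = neighbourhoodFactor K m
      Φ = bicliqueFactor K m
      0<Φ : 0 < Φ
      0<Φ = bicliqueFactor-positive m 0<K
      0<C : 0 < C
      0<C = <-≤-trans (*-positive 0<ℓ 0<Φ) ℓΦ≤C
      open CommonNeighbourhoods (common-neighbourhoods 0<C m (≤-trans (m≤m+n _ _) n₀≤n))
      open CommonElements (greedy-common-elements B N R m
                             (0<m≤a*b⇒0<b ((8 * K) ^ m) 0<C B-large) (λ i → N-large) (≤-trans (m≤n+m _ _) n₀≤n))
      ℓ≤∣survivors∣ : ℓ ≤ count survivors
      ℓ≤∣survivors∣ = *-cancelˡ-≤ Φ {{>-nonZero 0<Φ}} (begin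
        Φ * ℓ                           ≡⟨ *-comm Φ ℓ ⟩
        ℓ * Φ                           ≤⟨ ℓΦ≤C ⟩
        C                               ≤⟨ B-large ⟩
        (8 * K) ^ m * count B           ≤⟨ *-monoʳ-≤ ((8 * K) ^ m) survivors-large ⟩
        (8 * K) ^ m * ((2 * R) ^ m * count survivors) ≡⟨ *-assoc ((8 * K) ^ m) ((2 * R) ^ m) (count survivors) ⟨
        Φ * count survivors             ∎)
        where open ≤-Reasoning
      selection = ≤count⇒injection survivors ℓ≤∣survivors∣
      g = proj₁ selection
      g-injective = proj₁ (proj₂ selection)
      g-survives = proj₂ (proj₂ selection)

  length-filterᵇ-tabulate : ∀ {A : Set} (p : A → Bool) (f : Fin n → A) →
                            length (filterᵇ p (tabulate f)) ≡ count (p ∘ f)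
  length-filterᵇ-tabulate {zero}  p f = refl
  length-filterᵇ-tabulate {suc n} p f with p (f zero)
  ... | true  = cong suc (length-filterᵇ-tabulate p (f ∘ suc))
  ... | false = length-filterᵇ-tabulate p (f ∘ suc)

  length-filterᵇ-cartesianProduct : ∀ {A B : Set} (p : A × B → Bool) (f : Fin k → A) (g : Fin n → B) →
    length (filterᵇ p (cartesianProduct (tabulate f) (tabulate g))) ≡ ∑[ x < k ] count (λ y → p (f x , g y))
  length-filterᵇ-cartesianProduct {zero}  p f g = refl
  length-filterᵇ-cartesianProduct {suc k} p f g = begin
    length (filterᵇ p (map (f zero ,_) (tabulate g) ++ rest))
      ≡⟨ cong length (filter-++ (T? ∘ p) (map (f zero ,_) (tabulate g)) rest) ⟩
    length (filterᵇ p (map (f zero ,_) (tabulate g)) ++ filterᵇ p rest)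
      ≡⟨ length-++ (filterᵇ p (map (f zero ,_) (tabulate g))) ⟩
    length (filterᵇ p (map (f zero ,_) (tabulate g))) + length (filterᵇ p rest)
      ≡⟨ cong₂ _+_ (trans (cong (length ∘ filterᵇ p) (map-tabulate g (f zero ,_)))
                          (length-filterᵇ-tabulate p ((f zero ,_) ∘ g)))
                   (length-filterᵇ-cartesianProduct p (f ∘ suc) g) ⟩
    ∑[ x < suc k ] count (λ y → p (f x , g y)) ∎
    where
    open ≡-Reasoning
    rest = cartesianProduct (tabulate (f ∘ suc)) (tabulate g)

  linkEdgesOutside≤edgeCount : ∀ {C} (H : Hypergraph3 n) (a : Fin C → Fin n) v →
                               linkEdgesOutside H a v ≤ edgeCount (E H v)
  linkEdgesOutside≤edgeCount {n} H a v = ≤-trans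
    (≤-reflexive (length-filterᵇ-cartesianProduct test (λ x → x) (λ y → y)))
    (∑-mono-≤ λ x → count-mono λ y → edge x y)
    where
    test : Fin n × Fin n → Bool
    test (x , y) = (toℕ x <ᵇ toℕ y) ∧ not (inImage a x) ∧ not (inImage a y) ∧ E H v x y
    edge : ∀ x y → T (test (x , y)) → T (E H v x y)
    edge x y t = let _ , t₁ = T-∧⁻ (toℕ x <ᵇ toℕ y) t
                     _ , t₂ = T-∧⁻ (not (inImage a x)) t₁
                 in proj₂ (T-∧⁻ (not (inImage a y)) t₂)

  E-rotate : (H : Hypergraph3 n) → ∀ x y z → E H x y z ≡ E H y z x
  E-rotate H x y z = trans (sym₁₂ H x y z) (sym₂₃ H y x z)

  hypergraph-biclique : ∀ {n C K} (H : Hypergraph3 n) (a : Fin C → Fin n) m ℓ → 0 < ℓ → 0 < K →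
    ℓ * bicliqueFactor K m ≤ C → bicliqueThreshold K m < n →
    (∀ i → n * n ≤ K * linkEdgesOutside H a (a i)) →
    Σ (Fin m → Fin n) λ W₁ → Σ (Fin m → Fin n) λ W₂ → Σ (Fin ℓ → Fin C) λ g →
      Injective _≡_ _≡_ W₁ × Injective _≡_ _≡_ W₂ × Injective _≡_ _≡_ g ×
      ((i j : Fin m) → ¬ (W₁ i ≡ W₂ j)) ×
      ((i j : Fin m) (k : Fin ℓ) → E H (W₁ i) (W₂ j) (a (g k)) ≡ true)
  hypergraph-biclique {K = K} H a m ℓ 0<ℓ 0<K ℓΦ≤C n₀<n dense
    with CommonBiclique.biclique {{>-nonZero (≤-<-trans z≤n n₀<n)}} (λ i → E H (a i))
           (λ i → ≤-trans (dense i) (*-monoʳ-≤ K (linkEdgesOutside≤edgeCount H a (a i))))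
           m ℓ 0<ℓ 0<K ℓΦ≤C (<⇒≤ n₀<n)
  ... | X , Y , g , X-injective , Y-injective , g-injective , edges =
    X , Y , g , X-injective , Y-injective , g-injective ,
    (λ i j → proj₁ (proj₂ (distinct H _ _ _ (edge i j (fromℕ< 0<ℓ))))) ,
    (λ i j k → trans (sym (E-rotate H (a (g k)) (X i) (Y j))) (edge i j k))
    where
    edge : ∀ i j k → E H (a (g k)) (X i) (Y j) ≡ true
    edge i j k = Equivalence.to T-≡ (edges i j k)

  positive⇒inverse-bound : (η : ℚ) → Positive η →
    ∃ λ K → 0 < K × (∀ N e → η ℚ.* ((ℤ.+ N) / 1) ℚ.≤ (ℤ.+ e) / 1 → N ≤ K * e)
  positive⇒inverse-bound η@(mkℚ (ℤ.+ suc p) d _) _ = suc d , z<s , bound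
    where
    bound : ∀ N e → η ℚ.* ((ℤ.+ N) / 1) ℚ.≤ (ℤ.+ e) / 1 → N ≤ suc d * e
    bound N e ηN≤e = begin
      N                ≤⟨ m≤n*m N (suc p) ⟩
      suc p * N        ≡⟨ *-identityʳ _ ⟨
      suc p * N * 1    ≤⟨ drop‿+≤+ cross-multiplied ⟩
      e * (suc d * 1)  ≡⟨ cong (e *_) (*-identityʳ (suc d)) ⟩
      e * suc d        ≡⟨ *-comm e (suc d) ⟩
      suc d * e        ∎
      where
      open ≤-Reasoning
      unnormalised : ℚᵘ.mkℚᵘ (ℤ.+ suc p) d ℚᵘ.* ℚᵘ.mkℚᵘ (ℤ.+ N) 0 ℚᵘ.≤ ℚᵘ.mkℚᵘ (ℤ.+ e) 0
      unnormalised = ≤-respʳ-≃ (toℚᵘ-fromℚᵘ (ℚᵘ.mkℚᵘ (ℤ.+ e) 0))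
        (≤-respˡ-≃ (*-congˡ {ℚᵘ.mkℚᵘ (ℤ.+ suc p) d} (toℚᵘ-fromℚᵘ (ℚᵘ.mkℚᵘ (ℤ.+ N) 0)))
        (≤-respˡ-≃ (toℚᵘ-homo-* η ((ℤ.+ N) / 1)) (toℚᵘ-mono-≤ ηN≤e)))
      cross-multiplied : ℤ.+ (suc p * N * 1) ℤ.≤ ℤ.+ (e * (suc d * 1))
      cross-multiplied = subst₂ ℤ._≤_
        (sym (trans (pos-* (suc p * N) 1) (cong (ℤ._* ℤ.+ 1) (pos-* (suc p) N))))
        (sym (pos-* e (suc d * 1)))
        (drop-*≤* unnormalised)

open import Defs
open import Data.Bool using (true)
open import Data.Nat using (ℕ; _≥_; _>_; _*_)
open import Data.Integer using (+_)
open import Data.Rational using (ℚ; Positive; _≤_; _/_)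
open import Data.Fin using (Fin)
open import Data.Product using (Σ; _×_; _,_)
open import Function.Definitions using (Injective)
open import Relation.Nullary using (¬_)
open import Relation.Binary.PropositionalEquality using (_≡_)
open import Data.Nat.Properties using (≤-refl)
open LinkBicliques using (positive⇒inverse-bound; bicliqueFactor; bicliqueThreshold; hypergraph-biclique)

lemma3p6 : (η : ℚ) → Positive η → (m₁ ℓ₂ : ℕ) → m₁ ≥ 1 → ℓ₂ ≥ 1 →
    Σ ℕ λ C → Σ ℕ λ n₀ →
      (n : ℕ) → n > n₀ →
      (H : Hypergraph3 n) →
      (a : Fin C → Fin n) → Injective _≡_ _≡_ a →
      ((i : Fin C) →
        η Data.Rational.* ((+ (n * n)) / 1) ≤ (+ linkEdgesOutside H a (a i)) / 1) →
      Σ (Fin m₁ → Fin n) λ W₁ → Σ (Fin m₁ → Fin n) λ W₂ → Σ (Fin ℓ₂ → Fin C) λ g →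
        Injective _≡_ _≡_ W₁ × Injective _≡_ _≡_ W₂ × Injective _≡_ _≡_ g ×
        ((i j : Fin m₁) → ¬ (W₁ i ≡ W₂ j)) ×
        ((i j : Fin m₁) (k : Fin ℓ₂) → E H (W₁ i) (W₂ j) (a (g k)) ≡ true)
lemma3p6 η η>0 m ℓ _ ℓ≥1 =
  let K , 0<K , η-bound = positive⇒inverse-bound η η>0 in
  ℓ * bicliqueFactor K m , bicliqueThreshold K m ,
  λ n n>n₀ H a _ dense → hypergraph-biclique H a m ℓ ℓ≥1 0<K ≤-refl n>n₀ (λ i → η-bound _ _ (dense i))
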